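{- Let $L$ be a bounded distributive lattice (with $0\neq 1$), and let $\Phi(L)=\{(a,b)\in L\times L : a\le b\}$, ordered coordinatewise. Then $$\mathcal{I}_p(\Phi(L))=\{(I\times I)\cap \Phi(L) : I\in \mathcal{I}_p(L)\}\cup\{(I\times L)\cap\Phi(L) : I\in\mathcal{I}_p(L)\}.$$
   Context: $\Phi(L)$ is a bounded distributive lattice, a $(0,1)$-sublattice of $L\times L$ with componentwise operations. For a bounded distributive lattice $M$, $\mathcal{I}_p(M)$ denotes the set of prime ideals of $M$, where an ideal is a nonempty down-set closed under binary joins, and it is prime if it is not all of $M$ and its complement is closed under binary meets. -}

module Defs where

open import Level using (Level; _⊔_; suc)
open import Data.Product using (Σ; ∃; _×_; _,_; proj₁; proj₂)
open import Relation.Nullary using (¬_)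
open import Relation.Unary using (Pred)
open import Relation.Binary using (Rel)
open import Algebra.Core using (Op₂)
open import Relation.Binary.Lattice using (BoundedLattice)
import Relation.Binary.Lattice.Properties.JoinSemilattice as JP
import Relation.Binary.Lattice.Properties.MeetSemilattice as MP

module _ {a r : Level} {A : Set a} (_≤_ : Rel A r) (_∨_ _∧_ : Op₂ A) where

  record IsIdeal {p : Level} (I : Pred A p) : Set (a ⊔ r ⊔ p) where
    field
      nonempty : ∃ λ x → I x
      downset  : ∀ {x y} → y ≤ x → I x → I y
      joins    : ∀ {x y} → I x → I y → I (x ∨ y)

  record IsPrimeIdeal {p : Level} (I : Pred A p) : Set (a ⊔ r ⊔ p) where
    field
      isIdeal    : IsIdeal I
      proper     : ¬ (∀ x → I x)
      primeMeets : ∀ {x y} → ¬ I x → ¬ I y → ¬ I (x ∧ y)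

module PhiConstruction {c ℓ₁ ℓ₂ : Level} (L : BoundedLattice c ℓ₁ ℓ₂) where
  open BoundedLattice L

  Φ : Set (c ⊔ ℓ₂)
  Φ = Σ (Carrier × Carrier) (λ ab → proj₁ ab ≤ proj₂ ab)

  fst snd : Φ → Carrier
  fst ((x , _) , _) = x
  snd ((_ , y) , _) = y

  _≤Φ_ : Rel Φ ℓ₂
  u ≤Φ v = (fst u ≤ fst v) × (snd u ≤ snd v)

  _∨Φ_ : Op₂ Φ
  ((a , b) , a≤b) ∨Φ ((c' , d) , c≤d) =
    ((a ∨ c') , (b ∨ d)) , JP.∨-monotonic joinSemilattice a≤b c≤d

  _∧Φ_ : Op₂ Φ
  ((a , b) , a≤b) ∧Φ ((c' , d) , c≤d) =
    ((a ∧ c') , (b ∧ d)) , MP.∧-monotonic meetSemilattice a≤b c≤d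

  I×I∩Φ : {p : Level} → Pred Carrier p → Pred Φ p
  I×I∩Φ I u = I (fst u) × I (snd u)

  I×L∩Φ : {p : Level} → Pred Carrier p → Pred Φ p
  I×L∩Φ I u = I (fst u)

module Submission where

-- Every construction of a prime ideal in this file is a preimage: if
-- f : B → A is monotone, f (x ∨ y) ≤ f x ∨ f y and f x ∧ f y ≤ f (x ∧ y),
-- then for a prime ideal I of A the predicate I ∘ f is a prime ideal of B
-- as soon as it is nonempty and proper (preimage-prime).
--
-- (⊇) The projections fst, snd : Φ(L) → L are such maps with the diagonal
--     a ↦ (a,a) as a section, so I ∘ fst = (I × L) ∩ Φ(L) and
--     I ∘ snd ≐ (I × I) ∩ Φ(L) are prime for every prime I of L.
-- (⊆) For a prime P of Φ(L) we split on whether (0,1) ∈ P (excluded middle).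
--     If so, P = (I × L) ∩ Φ(L) for I = {a : (a,1) ∈ P}; if not,
--     P = (I × I) ∩ Φ(L) for I = {b : (0,b) ∈ P}. Both I are preimages of P
--     under the maps a ↦ (a,1) and b ↦ (0,b).

open import Defs
open import Level using (Level)
open import Data.Product using (Σ; ∃; _×_; _,_; proj₁; proj₂)
open import Data.Sum using (_⊎_; inj₁; inj₂)
open import Data.Empty using (⊥-elim)
open import Relation.Nullary using (¬_; yes; no)
open import Relation.Unary using (Pred; _≐_; _⊆_)
open import Relation.Binary using (Rel)
open import Algebra.Core using (Op₂)
open import Algebra.Definitions using (_DistributesOverˡ_)
open import Relation.Binary.Lattice using (BoundedLattice)
open import Axiom.ExcludedMiddle using (ExcludedMiddle)
import Relation.Binary.PropositionalEquality as ≡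
open ≡ using (_≡_; subst; sym)

prime-resp-≐ : {a r p : Level} {A : Set a} {_≤_ : Rel A r} {_∨_ _∧_ : Op₂ A}
               {P Q : Pred A p} → P ≐ Q →
               IsPrimeIdeal _≤_ _∨_ _∧_ Q → IsPrimeIdeal _≤_ _∨_ _∧_ P
prime-resp-≐ (P⊆Q , Q⊆P) prime = record
  { isIdeal = record
    { nonempty = let (x , qx) = nonempty in x , Q⊆P qx
    ; downset  = λ y≤x px → Q⊆P (downset y≤x (P⊆Q px))
    ; joins    = λ px py → Q⊆P (joins (P⊆Q px) (P⊆Q py))
    }
  ; proper     = λ all-P → proper (λ x → P⊆Q (all-P x))
  ; primeMeets = λ ¬px ¬py pxy → primeMeets (λ qx → ¬px (Q⊆P qx)) (λ qy → ¬py (Q⊆P qy)) (P⊆Q pxy)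
  }
  where
  open IsPrimeIdeal prime
  open IsIdeal isIdeal

preimage-prime :
  {a b r s p : Level} {A : Set a} {B : Set b}
  {_≤A_ : Rel A r} {_∨A_ _∧A_ : Op₂ A} {_≤B_ : Rel B s} {_∨B_ _∧B_ : Op₂ B}
  (f : B → A) →
  (∀ {x y} → x ≤B y → f x ≤A f y) →
  (∀ x y → f (x ∨B y) ≤A (f x ∨A f y)) →
  (∀ x y → (f x ∧A f y) ≤A f (x ∧B y)) →
  {I : Pred A p} → IsPrimeIdeal _≤A_ _∨A_ _∧A_ I →
  (∃ λ y → I (f y)) → ¬ (∀ y → I (f y)) →
  IsPrimeIdeal _≤B_ _∨B_ _∧B_ (λ y → I (f y))
preimage-prime f mono ∨-sub ∧-sup prime inhabited proper′ = record
  { isIdeal = record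
    { nonempty = inhabited
    ; downset  = λ y≤x ifx → downset (mono y≤x) ifx
    ; joins    = λ {x} {y} ifx ify → downset (∨-sub x y) (joins ifx ify)
    }
  ; proper     = proper′
  ; primeMeets = λ {x} {y} ¬ifx ¬ify ifxy → primeMeets ¬ifx ¬ify (downset (∧-sup x y) ifxy)
  }
  where
  open IsPrimeIdeal prime
  open IsIdeal isIdeal

module PrimeIdealsOfΦ {c ℓ₁ ℓ₂ p : Level} (L : BoundedLattice c ℓ₁ ℓ₂) where
  open BoundedLattice L renaming (⊥ to 0L; ⊤ to 1L)
  open PhiConstruction L

  PrimeL : Pred Carrier p → Set _
  PrimeL = IsPrimeIdeal _≤_ _∨_ _∧_

  PrimeΦ : Pred Φ p → Set _
  PrimeΦ = IsPrimeIdeal _≤Φ_ _∨Φ_ _∧Φ_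

  StandardPrime : Pred Φ p → Set _
  StandardPrime P = Σ (Pred Carrier p) λ I → PrimeL I × ((P ≐ I×I∩Φ I) ⊎ (P ≐ I×L∩Φ I))

  diagonal : Carrier → Φ
  diagonal a = (a , a) , refl

  withTop : Carrier → Φ
  withTop a = (a , 1L) , maximum a

  withBottom : Carrier → Φ
  withBottom b = (0L , b) , minimum b

  projection-prime : (π : Φ → Carrier) → (∀ {u v} → u ≤Φ v → π u ≤ π v) →
                     (∀ u v → π (u ∨Φ v) ≤ π u ∨ π v) →
                     (∀ u v → π u ∧ π v ≤ π (u ∧Φ v)) →
                     (∀ a → π (diagonal a) ≡ a) →
                     {I : Pred Carrier p} → PrimeL I → PrimeΦ (λ u → I (π u))
  projection-prime π mono ∨-sub ∧-sup section {I} prime =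
    preimage-prime π mono ∨-sub ∧-sup prime inhabited proper′
    where
    open IsPrimeIdeal prime
    open IsIdeal isIdeal
    inhabited : ∃ λ u → I (π u)
    inhabited = let (x , ix) = nonempty in diagonal x , subst I (sym (section x)) ix
    proper′ : ¬ (∀ u → I (π u))
    proper′ all-I = proper (λ x → subst I (section x) (all-I (diagonal x)))

  I×L-prime : {I : Pred Carrier p} → PrimeL I → PrimeΦ (I×L∩Φ I)
  I×L-prime = projection-prime fst proj₁ (λ _ _ → refl) (λ _ _ → refl) (λ _ → ≡.refl)

  -- Since a ≤ b and I is a down-set, (I × I) ∩ Φ(L) is the preimage of I under snd.
  I×I≐I∘snd : {I : Pred Carrier p} → PrimeL I → I×I∩Φ I ≐ (λ u → I (snd u))
  I×I≐I∘snd prime = proj₂ , λ { {(_ , a≤b)} ib → IsIdeal.downset (IsPrimeIdeal.isIdeal prime) a≤b ib , ib }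

  I×I-prime : {I : Pred Carrier p} → PrimeL I → PrimeΦ (I×I∩Φ I)
  I×I-prime prime = prime-resp-≐ (I×I≐I∘snd prime)
    (projection-prime snd proj₂ (λ _ _ → refl) (λ _ _ → refl) (λ _ → ≡.refl) prime)

  standard⇒prime : (P : Pred Φ p) → StandardPrime P → PrimeΦ P
  standard⇒prime P (I , prime , inj₁ P≐I×I) = prime-resp-≐ P≐I×I (I×I-prime prime)
  standard⇒prime P (I , prime , inj₂ P≐I×L) = prime-resp-≐ P≐I×L (I×L-prime prime)

  module _ (P : Pred Φ p) (prime : PrimeΦ P) where
    open IsPrimeIdeal prime
    open IsIdeal isIdeal

    zero-one : Φ
    zero-one = withBottom 1L

    -- If (0,1) ∈ P then P = (I × L) ∩ Φ(L) with I = {a : (a,1) ∈ P}: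
    -- (a,b) ∈ P gives (a,1) ≤ (a,b) ∨ (0,1) ∈ P, and (a,b) ≤ (a,1).
    prime-containing-zero-one : P zero-one → StandardPrime P
    prime-containing-zero-one p01 = I , prime-I , inj₂ (P⊆I×L , I×L⊆P)
      where
      I : Pred Carrier p
      I a = P (withTop a)
      prime-I : PrimeL I
      prime-I = preimage-prime withTop (λ a≤b → a≤b , refl)
        (λ x y → refl , x≤x∨y 1L 1L) (λ x y → refl , maximum _) prime
        (0L , downset (refl , refl) p01)
        (λ all-I → proper (λ u → downset (maximum (fst u) , maximum (snd u)) (all-I 1L)))
      P⊆I×L : P ⊆ I×L∩Φ I
      P⊆I×L {(a , b) , _} pu = downset (x≤x∨y a 0L , y≤x∨y b 1L) (joins pu p01)
      I×L⊆P : I×L∩Φ I ⊆ P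
      I×L⊆P {(_ , b) , _} ia = downset (refl , maximum b) ia

    -- If (0,1) ∉ P then P = (I × I) ∩ Φ(L) with I = {b : (0,b) ∈ P}:
    -- (0,a), (0,b) ≤ (a,b); conversely (a,b) ∧ (0,1) ≤ (0,b) ∈ P, so
    -- primality forces (a,b) ∈ P (here excluded middle is used).
    prime-avoiding-zero-one : ExcludedMiddle p → ¬ P zero-one → StandardPrime P
    prime-avoiding-zero-one em ¬p01 = I , prime-I , inj₁ (P⊆I×I , I×I⊆P)
      where
      I : Pred Carrier p
      I b = P (withBottom b)
      prime-I : PrimeL I
      prime-I = preimage-prime withBottom (λ a≤b → refl , a≤b)
        (λ x y → minimum _ , refl) (λ x y → x∧y≤x 0L 0L , refl) prime
        (let (((a , b) , _) , pu) = nonempty in b , downset (minimum a , refl) pu)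
        (λ all-I → ¬p01 (all-I 1L))
      P⊆I×I : P ⊆ I×I∩Φ I
      P⊆I×I {(a , b) , a≤b} pu = downset (minimum a , a≤b) pu , downset (minimum a , refl) pu
      I×I⊆P : I×I∩Φ I ⊆ P
      I×I⊆P {u@((a , b) , _)} (_ , ib) with em {P u}
      ... | yes pu  = pu
      ... | no ¬pu = ⊥-elim (primeMeets ¬pu ¬p01 (downset (x∧y≤y a 0L , x∧y≤x b 1L) ib))

    prime⇒standard : ExcludedMiddle p → StandardPrime P
    prime⇒standard em with em {P zero-one}
    ... | yes p01  = prime-containing-zero-one p01
    ... | no ¬p01 = prime-avoiding-zero-one em ¬p01

corollary4p4 : {c ℓ₁ ℓ₂ p : Level} → ExcludedMiddle p →
    (L : BoundedLattice c ℓ₁ ℓ₂) →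
    _DistributesOverˡ_ (BoundedLattice._≈_ L) (BoundedLattice._∧_ L) (BoundedLattice._∨_ L) →
    ¬ (BoundedLattice._≈_ L (BoundedLattice.⊥ L) (BoundedLattice.⊤ L)) →
    (P : Pred (PhiConstruction.Φ L) p) →
    (IsPrimeIdeal (PhiConstruction._≤Φ_ L) (PhiConstruction._∨Φ_ L) (PhiConstruction._∧Φ_ L) P →
      Σ (Pred (BoundedLattice.Carrier L) p) (λ I →
        IsPrimeIdeal (BoundedLattice._≤_ L) (BoundedLattice._∨_ L) (BoundedLattice._∧_ L) I ×
        ((P ≐ PhiConstruction.I×I∩Φ L I) ⊎ (P ≐ PhiConstruction.I×L∩Φ L I))))
    ×
    (Σ (Pred (BoundedLattice.Carrier L) p) (λ I →
        IsPrimeIdeal (BoundedLattice._≤_ L) (BoundedLattice._∨_ L) (BoundedLattice._∧_ L) I ×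
        ((P ≐ PhiConstruction.I×I∩Φ L I) ⊎ (P ≐ PhiConstruction.I×L∩Φ L I))) →
      IsPrimeIdeal (PhiConstruction._≤Φ_ L) (PhiConstruction._∨Φ_ L) (PhiConstruction._∧Φ_ L) P)
corollary4p4 em L _ _ P =
  (λ prime → prime⇒standard P prime em) , standard⇒prime P
  where open PrimeIdealsOfΦ L
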